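{- Let $\lambda$ be a nonzero real number and $m$ a positive integer. For every integer $n\ge 0$, $$d_{m,\lambda}(n,x)=\sum_{k=0}^{n}\Big\{\sum_{j=k}^{n}S_{1,\lambda}(j,k)\,W_{m,\lambda}(n,j)\Big\}\phi_{k,\lambda}(x).$$
   Context: For $\lambda\neq 0$: $(x)_{0,\lambda}=1$ and $(x)_{n,\lambda}=x(x-\lambda)\cdots(x-(n-1)\lambda)$ for $n\ge1$. The degenerate exponential is $e_\lambda^{x}(t)=\sum_{k\ge0}(x)_{k,\lambda}\frac{t^k}{k!}=(1+\lambda t)^{x/\lambda}$, $e_\lambda(t)=e_\lambda^1(t)$, and $\log_\lambda(1+t)=\frac{1}{\lambda}\big((1+t)^\lambda-1\big)$. The degenerate Stirling numbers of the first kind are defined by $\frac{1}{k!}(\log_\lambda(1+t))^k=\sum_{n\ge k}S_{1,\lambda}(n,k)\frac{t^n}{n!}$. The degenerate Whitney numbers of the second kind are defined by $e_\lambda(t)\frac{1}{k!}\Big(\frac{e_\lambda^{m}(t)-1}{m}\Big)^k=\sum_{n\ge k}W_{m,\lambda}(n,k)\frac{t^n}{n!}$, and the fully degenerate Dowling polynomials are $d_{m,\lambda}(n,x)=\sum_{k=0}^{n}W_{m,\lambda}(n,k)(x)_{k,\lambda}$. The fully degenerate Bell polynomials $\phi_{n,\lambda}(x)$ are defined by $e_\lambda^{x}\big(e_\lambda(t)-1\big)=\sum_{n\ge0}\phi_{n,\lambda}(x)\frac{t^n}{n!}$. -}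

module Defs where

open import Level using (Level; _⊔_) renaming (suc to lsuc)
open import Algebra.Bundles using (CommutativeRing)
open import Data.Nat as ℕ using (ℕ; zero; suc; _∸_; NonZero)
open import Relation.Nullary using (¬_)

natR : ∀ {c ℓ} (R : CommutativeRing c ℓ) → ℕ → CommutativeRing.Carrier R
natR R zero    = CommutativeRing.0# R
natR R (suc n) = CommutativeRing._+_ R (CommutativeRing.1# R) (natR R n)

-- A field of characteristic zero (ℝ is one).  Agda's stdlib has no reals
-- and no Field bundle, so we work over an arbitrary such field.
record Field (c ℓ : Level) : Set (lsuc (c ⊔ ℓ)) where
  field
    commRing : CommutativeRing c ℓ
  open CommutativeRing commRing
  field
    inv      : (x : Carrier) → ¬ (x ≈ 0#) → Carrier
    inv-inv  : ∀ x (p : ¬ (x ≈ 0#)) → x * inv x p ≈ 1#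
    char0    : ∀ n → ¬ (natR commRing (suc n) ≈ 0#)

module FieldDefs {c ℓ} (F : Field c ℓ) where
  open Field F public using (commRing; inv; char0)
  open CommutativeRing commRing public

  sumBelow : ℕ → (ℕ → Carrier) → Carrier
  sumBelow zero    f = 0#
  sumBelow (suc n) f = sumBelow n f + f n

  sumFromTo : ℕ → ℕ → (ℕ → Carrier) → Carrier
  sumFromTo a b f = sumBelow (suc b ∸ a) (λ i → f (a ℕ.+ i))

  ↑ : ℕ → Carrier
  ↑ = natR commRing

  invSuc : ℕ → Carrier
  invSuc n = inv (↑ (suc n)) (char0 n)

  invFact : ℕ → Carrier
  invFact zero    = 1#
  invFact (suc k) = invFact k * invSuc k

  fact : ℕ → Carrier
  fact zero    = 1#
  fact (suc k) = fact k * ↑ (suc k)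

  falling : (λ' x : Carrier) → ℕ → Carrier
  falling λ' x zero    = 1#
  falling λ' x (suc n) = falling λ' x n * (x - ↑ n * λ')

  -- Formal power series in t: ordinary coefficient sequences, f n = [tⁿ] f.
  Series : Set c
  Series = ℕ → Carrier

  _⊕_ : Series → Series → Series
  (f ⊕ g) n = f n + g n

  _⊖_ : Series → Series → Series
  (f ⊖ g) n = f n - g n

  _⊙_ : Carrier → Series → Series
  (a ⊙ f) n = a * f n

  _⊗_ : Series → Series → Series
  (f ⊗ g) n = sumBelow (suc n) (λ i → f i * g (n ∸ i))

  oneS : Series
  oneS zero    = 1#
  oneS (suc n) = 0#

  powS : Series → ℕ → Series
  powS f zero    = oneS
  powS f (suc k) = powS f k ⊗ f

  egf : (ℕ → Carrier) → Series
  egf a n = a n * invFact n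

  egfCoeff : Series → ℕ → Carrier
  egfCoeff f n = fact n * f n

  eλ^ : (λ' x : Carrier) → Series
  eλ^ λ' x = egf (falling λ' x)

  eλ : Carrier → Series
  eλ λ' = eλ^ λ' 1#

  -- e_λ^x(u(t)) = Σ_k (x)_{k,λ} u(t)^k / k!  for u with zero constant term
  -- (the coefficient of tⁿ only receives contributions from k ≤ n).
  eλ^∘ : (λ' x : Carrier) → Series → Series
  eλ^∘ λ' x u n = sumBelow (suc n) (λ k → (falling λ' x k * invFact k) * powS u k n)

  -- (1+t)^a = Σ_n (a)_{n,1} tⁿ/n!   (binomial series)
  onePlusTPow : Carrier → Series
  onePlusTPow a = egf (falling 1# a)

  logλ : (λ' : Carrier) → ¬ (λ' ≈ 0#) → Series
  logλ λ' p = inv λ' p ⊙ (onePlusTPow λ' ⊖ oneS)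

  S1 : (λ' : Carrier) → ¬ (λ' ≈ 0#) → ℕ → ℕ → Carrier
  S1 λ' p n k = egfCoeff (invFact k ⊙ powS (logλ λ' p) k) n

  natR-nz : (m : ℕ) → {{NonZero m}} → ¬ (↑ m ≈ 0#)
  natR-nz (suc m) = char0 m

  W : (m : ℕ) → {{NonZero m}} → (λ' : Carrier) → ℕ → ℕ → Carrier
  W m λ' n k = egfCoeff (eλ λ' ⊗ (invFact k ⊙ powS (inv (↑ m) (natR-nz m) ⊙ (eλ^ λ' (↑ m) ⊖ oneS)) k)) n

  dowling : (m : ℕ) → {{NonZero m}} → (λ' : Carrier) → ℕ → Carrier → Carrier
  dowling m λ' n x = sumFromTo 0 n (λ k → W m λ' n k * falling λ' x k)

  phi : (λ' : Carrier) → ℕ → Carrier → Carrier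
  phi λ' n x = egfCoeff (eλ^∘ λ' x (eλ λ' ⊖ oneS)) n

{-# OPTIONS --safe #-}
module Submission where

-- Since S_{1,λ}(j,k) = 0 for j < k, the inner sum may run over all j ≤ n.
-- Substituting t ↦ log_λ(1+t) into the generating function e_λ^x(e_λ(t) - 1) of the φ's gives
-- e_λ^x(e_λ(log_λ(1+t)) - 1) = e_λ^x(t), because e_λ(log_λ(1+t)) and 1 + t both solve
-- (1+t) P' = P with P(0) = 1.  Comparing coefficients of t^j/j! yields the identity.

open import Defs
open import Algebra.Bundles using (CommutativeRing)
import Algebra.Properties.Ring as RingProperties
import Algebra.Solver.Ring
open import Algebra.Solver.Ring.AlmostCommutativeRing
  using (AlmostCommutativeRing; fromCommutativeRing; _-Raw-AlmostCommutative⟶_)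
open import Data.Empty using (⊥-elim)
open import Data.Integer as ℤ using (ℤ; +_; -[1+_]; ∣_∣; sign)
import Data.Integer.Properties as ℤ
open import Data.Maybe using (Maybe; just; nothing)
open import Data.Nat as ℕ using (ℕ; zero; suc; NonZero; _<_; _≤_; z≤n; s≤s)
import Data.Nat.Properties as ℕ
open import Data.Sign as Sign using (Sign)
open import Data.Sum using (inj₁; inj₂)
open import Relation.Binary.PropositionalEquality as ≡ using (_≡_; _≢_)
open import Relation.Nullary using (¬_; yes; no)

-- The ring solver needs a coefficient ring with decidable equality; ℤ, mapped into R, serves.
module IntegerRingSolver {c ℓ} (R : CommutativeRing c ℓ) where
  open CommutativeRing R
  open RingProperties ring using (-0#≈0#; -‿involutive; -‿+-comm; -1*x≈-x)
  open import Relation.Binary.Reasoning.Setoid setoid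

  private
    ↑ : ℕ → Carrier
    ↑ = natR R

  natR-+ : ∀ m n → ↑ (m ℕ.+ n) ≈ ↑ m + ↑ n
  natR-+ zero    n = sym (+-identityˡ _)
  natR-+ (suc m) n = trans (+-congˡ (natR-+ m n)) (sym (+-assoc _ _ _))

  natR-* : ∀ m n → ↑ (m ℕ.* n) ≈ ↑ m * ↑ n
  natR-* zero    n = sym (zeroˡ _)
  natR-* (suc m) n = begin
    ↑ (n ℕ.+ m ℕ.* n)     ≈⟨ natR-+ n (m ℕ.* n) ⟩
    ↑ n + ↑ (m ℕ.* n)     ≈⟨ +-cong (sym (*-identityˡ _)) (natR-* m n) ⟩
    1# * ↑ n + ↑ m * ↑ n  ≈⟨ distribʳ _ _ _ ⟨
    (1# + ↑ m) * ↑ n      ∎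

  intR : ℤ → Carrier
  intR (+ n)      = ↑ n
  intR -[1+ n ]   = - ↑ (suc n)

  private
    signR : Sign → Carrier
    signR Sign.+ = 1#
    signR Sign.- = - 1#

    signR-* : ∀ s t → signR (s Sign.* t) ≈ signR s * signR t
    signR-* Sign.- Sign.- = sym (trans (-1*x≈-x _) (-‿involutive _))
    signR-* Sign.- Sign.+ = sym (*-identityʳ _)
    signR-* Sign.+ Sign.- = sym (*-identityˡ _)
    signR-* Sign.+ Sign.+ = sym (*-identityˡ _)

    intR-◃ : ∀ s n → intR (s ℤ.◃ n) ≈ signR s * ↑ n
    intR-◃ s       zero    = sym (zeroʳ _)
    intR-◃ Sign.- (suc n) = sym (-1*x≈-x _)
    intR-◃ Sign.+ (suc n) = sym (*-identityˡ _)

    intR-signAbs : ∀ i → intR i ≈ signR (sign i) * ↑ ∣ i ∣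
    intR-signAbs -[1+ n ] = sym (-1*x≈-x _)
    intR-signAbs (+ n)    = sym (*-identityˡ _)

    suc-sub-suc : ∀ m n → ↑ m - ↑ n ≈ ↑ (suc m) - ↑ (suc n)
    suc-sub-suc m n = begin
      ↑ m - ↑ n                        ≈⟨ +-identityˡ _ ⟨
      0# + (↑ m - ↑ n)                 ≈⟨ +-congʳ (-‿inverseʳ 1#) ⟨
      (1# - 1#) + (↑ m - ↑ n)          ≈⟨ +-assoc _ _ _ ⟩
      1# + (- 1# + (↑ m - ↑ n))        ≈⟨ +-congˡ (+-assoc _ _ _) ⟨
      1# + ((- 1# + ↑ m) - ↑ n)        ≈⟨ +-congˡ (+-congʳ (+-comm _ _)) ⟩
      1# + ((↑ m - 1#) - ↑ n)          ≈⟨ +-congˡ (+-assoc _ _ _) ⟩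
      1# + (↑ m + (- 1# - ↑ n))        ≈⟨ +-assoc _ _ _ ⟨
      (1# + ↑ m) + (- 1# - ↑ n)        ≈⟨ +-congˡ (-‿+-comm _ _) ⟩
      ↑ (suc m) - ↑ (suc n)            ∎

  intR-⊖ : ∀ m n → intR (m ℤ.⊖ n) ≈ ↑ m - ↑ n
  intR-⊖ zero    zero    = sym (-‿inverseʳ 0#)
  intR-⊖ zero    (suc n) = sym (+-identityˡ _)
  intR-⊖ (suc m) zero    = sym (trans (+-congˡ -0#≈0#) (+-identityʳ _))
  intR-⊖ (suc m) (suc n) = begin
    intR (suc m ℤ.⊖ suc n)  ≡⟨ ≡.cong intR (ℤ.[1+m]⊖[1+n]≡m⊖n m n) ⟩
    intR (m ℤ.⊖ n)          ≈⟨ intR-⊖ m n ⟩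
    ↑ m - ↑ n               ≈⟨ suc-sub-suc m n ⟩
    ↑ (suc m) - ↑ (suc n)   ∎

  intR-+ : ∀ i j → intR (i ℤ.+ j) ≈ intR i + intR j
  intR-+ -[1+ m ] -[1+ n ] = begin
    - (1# + ↑ (suc (m ℕ.+ n)))    ≈⟨ -‿cong (+-congˡ (natR-+ (suc m) n)) ⟩
    - (1# + (↑ (suc m) + ↑ n))    ≈⟨ -‿cong (trans (sym (+-assoc _ _ _)) (trans (+-congʳ (+-comm _ _)) (+-assoc _ _ _))) ⟩
    - (↑ (suc m) + ↑ (suc n))     ≈⟨ -‿+-comm _ _ ⟨
    - ↑ (suc m) + - ↑ (suc n)     ∎
  intR-+ -[1+ m ] (+ n)    = trans (intR-⊖ n (suc m)) (+-comm _ _)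
  intR-+ (+ m)    -[1+ n ] = intR-⊖ m (suc n)
  intR-+ (+ m)    (+ n)    = natR-+ m n

  intR-* : ∀ i j → intR (i ℤ.* j) ≈ intR i * intR j
  intR-* i j = begin
    intR (sign i Sign.* sign j ℤ.◃ ∣ i ∣ ℕ.* ∣ j ∣)
      ≈⟨ intR-◃ (sign i Sign.* sign j) (∣ i ∣ ℕ.* ∣ j ∣) ⟩
    signR (sign i Sign.* sign j) * ↑ (∣ i ∣ ℕ.* ∣ j ∣)
      ≈⟨ *-cong (signR-* (sign i) (sign j)) (natR-* ∣ i ∣ ∣ j ∣) ⟩
    (signR (sign i) * signR (sign j)) * (↑ ∣ i ∣ * ↑ ∣ j ∣)
      ≈⟨ interchange _ _ _ _ ⟩
    (signR (sign i) * ↑ ∣ i ∣) * (signR (sign j) * ↑ ∣ j ∣)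
      ≈⟨ *-cong (intR-signAbs i) (intR-signAbs j) ⟨
    intR i * intR j ∎
    where
    interchange : ∀ a b c d → (a * b) * (c * d) ≈ (a * c) * (b * d)
    interchange a b c d = begin
      (a * b) * (c * d)  ≈⟨ *-assoc _ _ _ ⟩
      a * (b * (c * d))  ≈⟨ *-congˡ (*-assoc _ _ _) ⟨
      a * ((b * c) * d)  ≈⟨ *-congˡ (*-congʳ (*-comm _ _)) ⟩
      a * ((c * b) * d)  ≈⟨ *-congˡ (*-assoc _ _ _) ⟩
      a * (c * (b * d))  ≈⟨ *-assoc _ _ _ ⟨
      (a * c) * (b * d)  ∎

  intR-neg : ∀ i → intR (ℤ.- i) ≈ - intR i
  intR-neg -[1+ n ]  = sym (-‿involutive _)
  intR-neg (+ zero)  = sym -0#≈0#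
  intR-neg (+ suc n) = refl

  private
    R′ : AlmostCommutativeRing c ℓ
    R′ = fromCommutativeRing R

    intR-morphism : ℤ.+-*-rawRing -Raw-AlmostCommutative⟶ R′
    intR-morphism = record
      { ⟦_⟧ = intR ; +-homo = intR-+ ; *-homo = intR-* ; -‿homo = intR-neg
      ; 0-homo = refl ; 1-homo = +-identityʳ _ }

    intR-≟ : ∀ i j → Maybe (intR i ≈ intR j)
    intR-≟ i j with i ℤ.≟ j
    ... | yes ≡.refl = just refl
    ... | no _       = nothing

  open Algebra.Solver.Ring ℤ.+-*-rawRing R′ intR-morphism intR-≟ public

module FormalPowerSeries {c ℓ} (F : Field c ℓ) where
  open FieldDefs F
  open Field F using (inv-inv)
  open RingProperties ring using (-0#≈0#; -‿+-comm; -‿distribˡ-*)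
  open IntegerRingSolver commRing using (natR-+; solve; _:+_; _:*_; _:-_; _:=_)
  open import Relation.Binary.Reasoning.Setoid setoid

  Σ : ℕ → (ℕ → Carrier) → Carrier
  Σ = sumBelow

  Σ-cong-< : ∀ n {f g : ℕ → Carrier} → (∀ i → i < n → f i ≈ g i) → Σ n f ≈ Σ n g
  Σ-cong-< zero    h = refl
  Σ-cong-< (suc n) h = +-cong (Σ-cong-< n (λ i i<n → h i (ℕ.m<n⇒m<1+n i<n))) (h n ℕ.≤-refl)

  Σ-cong : ∀ n {f g : ℕ → Carrier} → (∀ i → f i ≈ g i) → Σ n f ≈ Σ n g
  Σ-cong n h = Σ-cong-< n (λ i _ → h i)

  Σ-≈0 : ∀ n {f : ℕ → Carrier} → (∀ i → i < n → f i ≈ 0#) → Σ n f ≈ 0#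
  Σ-≈0 zero    h = refl
  Σ-≈0 (suc n) h = trans (+-cong (Σ-≈0 n (λ i i<n → h i (ℕ.m<n⇒m<1+n i<n))) (h n ℕ.≤-refl)) (+-identityˡ _)

  Σ-distrib-+ : ∀ n (f g : ℕ → Carrier) → Σ n (λ i → f i + g i) ≈ Σ n f + Σ n g
  Σ-distrib-+ zero    f g = sym (+-identityˡ _)
  Σ-distrib-+ (suc n) f g = trans (+-congʳ (Σ-distrib-+ n f g))
    (solve 4 (λ a b x y → (a :+ b) :+ (x :+ y) := (a :+ x) :+ (b :+ y)) refl _ _ _ _)

  *-distribˡ-Σ : ∀ n a (f : ℕ → Carrier) → a * Σ n f ≈ Σ n (λ i → a * f i)
  *-distribˡ-Σ zero    a f = zeroʳ a
  *-distribˡ-Σ (suc n) a f = trans (distribˡ _ _ _) (+-congʳ (*-distribˡ-Σ n a f))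

  *-distribʳ-Σ : ∀ n a (f : ℕ → Carrier) → Σ n f * a ≈ Σ n (λ i → f i * a)
  *-distribʳ-Σ n a f = trans (*-comm _ _) (trans (*-distribˡ-Σ n a f) (Σ-cong n (λ i → *-comm _ _)))

  -‿distrib-Σ : ∀ n (f : ℕ → Carrier) → - Σ n f ≈ Σ n (λ i → - f i)
  -‿distrib-Σ zero    f = -0#≈0#
  -‿distrib-Σ (suc n) f = trans (sym (-‿+-comm _ _)) (+-congʳ (-‿distrib-Σ n f))

  Σ-head : ∀ n (f : ℕ → Carrier) → Σ (suc n) f ≈ f 0 + Σ n (λ i → f (suc i))
  Σ-head zero    f = trans (+-identityˡ _) (sym (+-identityʳ _))
  Σ-head (suc n) f = trans (+-congʳ (Σ-head n f)) (+-assoc _ _ _)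

  Σ-split : ∀ a b (f : ℕ → Carrier) → Σ (a ℕ.+ b) f ≈ Σ a f + Σ b (λ i → f (a ℕ.+ i))
  Σ-split a zero    f = trans (reflexive (≡.cong (λ z → Σ z f) (ℕ.+-identityʳ a))) (sym (+-identityʳ _))
  Σ-split a (suc b) f = begin
    Σ (a ℕ.+ suc b) f                              ≡⟨ ≡.cong (λ z → Σ z f) (ℕ.+-suc a b) ⟩
    Σ (a ℕ.+ b) f + f (a ℕ.+ b)                    ≈⟨ +-congʳ (Σ-split a b f) ⟩
    (Σ a f + Σ b (λ i → f (a ℕ.+ i))) + f (a ℕ.+ b) ≈⟨ +-assoc _ _ _ ⟩
    Σ a f + Σ (suc b) (λ i → f (a ℕ.+ i))          ∎

  Σ-comm : ∀ n m (f : ℕ → ℕ → Carrier) → Σ n (λ i → Σ m (λ j → f i j)) ≈ Σ m (λ j → Σ n (λ i → f i j))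
  Σ-comm zero    m f = sym (Σ-≈0 m (λ _ _ → refl))
  Σ-comm (suc n) m f = trans (+-congʳ (Σ-comm n m f)) (sym (Σ-distrib-+ m _ _))

  Σ-extend : ∀ n m {f : ℕ → Carrier} → n ≤ m → (∀ i → n ≤ i → i < m → f i ≈ 0#) → Σ m f ≈ Σ n f
  Σ-extend n zero z≤n h = refl
  Σ-extend n (suc m) n≤1+m h with ℕ.m≤n⇒m<n∨m≡n n≤1+m
  ... | inj₂ ≡.refl = refl
  ... | inj₁ n<1+m  = trans
    (+-cong (Σ-extend n m (ℕ.≤-pred n<1+m) (λ i n≤i i<m → h i n≤i (ℕ.m<n⇒m<1+n i<m)))
            (h m (ℕ.≤-pred n<1+m) ℕ.≤-refl))
    (+-identityʳ _)

  Σ-single : ∀ n k {f : ℕ → Carrier} → k < n → (∀ i → i < n → i ≢ k → f i ≈ 0#) → Σ n f ≈ f k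
  Σ-single (suc n) k {f} k<1+n h with k ℕ.≟ n
  ... | yes ≡.refl = trans
    (+-congʳ (Σ-≈0 n (λ i i<n → h i (ℕ.m<n⇒m<1+n i<n) (λ i≡n → ℕ.<-irrefl i≡n i<n))))
    (+-identityˡ _)
  ... | no k≢n = trans
    (+-cong (Σ-single n k (ℕ.≤∧≢⇒< (ℕ.≤-pred k<1+n) k≢n) (λ i i<n → h i (ℕ.m<n⇒m<1+n i<n)))
            (h n ℕ.≤-refl (λ n≡k → k≢n (≡.sym n≡k))))
    (+-identityʳ _)

  sumFromTo≈Σ : ∀ k n (f : ℕ → Carrier) → (∀ j → j < k → f j ≈ 0#) → sumFromTo k n f ≈ Σ (suc n) f
  sumFromTo≈Σ k n f below with k ℕ.≤? suc n
  ... | yes k≤1+n = sym (begin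
    Σ (suc n) f                       ≡⟨ ≡.cong (λ z → Σ z f) (ℕ.m+[n∸m]≡n k≤1+n) ⟨
    Σ (k ℕ.+ (suc n ℕ.∸ k)) f         ≈⟨ Σ-split k (suc n ℕ.∸ k) f ⟩
    Σ k f + sumFromTo k n f           ≈⟨ +-congʳ (Σ-≈0 k below) ⟩
    0# + sumFromTo k n f              ≈⟨ +-identityˡ _ ⟩
    sumFromTo k n f                   ∎)
  ... | no k≰1+n = trans
    (reflexive (≡.cong (λ z → Σ z (λ i → f (k ℕ.+ i))) (ℕ.m≤n⇒m∸n≡0 (ℕ.<⇒≤ (ℕ.≰⇒> k≰1+n)))))
    (sym (Σ-≈0 (suc n) (λ j j<1+n → below j (ℕ.<-trans j<1+n (ℕ.≰⇒> k≰1+n)))))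

  Σ-triangular-swap : ∀ n (s : ℕ → ℕ → Carrier) (w φ a : ℕ → Carrier) →
    (∀ j k → j < k → s j k ≈ 0#) →
    (∀ j → j ≤ n → Σ (suc n) (λ k → s j k * φ k) ≈ a j) →
    sumFromTo 0 n (λ k → sumFromTo k n (λ j → s j k * w j) * φ k) ≈ sumFromTo 0 n (λ j → w j * a j)
  Σ-triangular-swap n s w φ a s-upper inversion = begin
    Σ N (λ k → sumFromTo k n (λ j → s j k * w j) * φ k)
      ≈⟨ Σ-cong N (λ k → *-congʳ (sumFromTo≈Σ k n _ (λ j j<k → trans (*-congʳ (s-upper j k j<k)) (zeroˡ _)))) ⟩
    Σ N (λ k → Σ N (λ j → s j k * w j) * φ k)
      ≈⟨ Σ-cong N (λ k → trans (*-distribʳ-Σ N _ _) (Σ-cong N (λ j →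
           solve 3 (λ s w f → (s :* w) :* f := w :* (s :* f)) refl _ _ _))) ⟩
    Σ N (λ k → Σ N (λ j → w j * (s j k * φ k)))
      ≈⟨ Σ-comm N N _ ⟩
    Σ N (λ j → Σ N (λ k → w j * (s j k * φ k)))
      ≈⟨ Σ-cong-< N (λ j j<N → trans (sym (*-distribˡ-Σ N _ _)) (*-congˡ (inversion j (ℕ.≤-pred j<N)))) ⟩
    Σ N (λ j → w j * a j) ∎
    where
      N : ℕ
      N = suc n

  δ : ℕ → ℕ → Carrier
  δ m k with m ℕ.≟ k
  ... | yes _ = 1#
  ... | no _  = 0#

  δ-refl : ∀ m → δ m m ≈ 1#
  δ-refl m with m ℕ.≟ m
  ... | yes _   = refl
  ... | no m≢m = ⊥-elim (m≢m ≡.refl)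

  δ-≢ : ∀ {m k} → m ≢ k → δ m k ≈ 0#
  δ-≢ {m} {k} m≢k with m ℕ.≟ k
  ... | yes m≡k = ⊥-elim (m≢k m≡k)
  ... | no _    = refl

  δ-cong : ∀ {m k m′ k′} → m ≡ m′ → k ≡ k′ → δ m k ≈ δ m′ k′
  δ-cong ≡.refl ≡.refl = refl

  δ-sym : ∀ m k → δ m k ≈ δ k m
  δ-sym m k with m ℕ.≟ k
  ... | yes ≡.refl = sym (δ-refl m)
  ... | no m≢k     = sym (δ-≢ (λ k≡m → m≢k (≡.sym k≡m)))

  δ-suc : ∀ m k → δ (suc m) (suc k) ≈ δ m k
  δ-suc m k with m ℕ.≟ k
  ... | yes ≡.refl = δ-refl (suc m)
  ... | no m≢k     = δ-≢ (λ e → m≢k (ℕ.suc-injective e))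

  δ-+ˡ : ∀ a b n → a ≤ n → δ (a ℕ.+ b) n ≈ δ b (n ℕ.∸ a)
  δ-+ˡ a b n a≤n with b ℕ.≟ n ℕ.∸ a
  ... | yes ≡.refl = trans (δ-cong (ℕ.m+[n∸m]≡n a≤n) ≡.refl) (δ-refl n)
  ... | no b≢n∸a   = δ-≢ (λ e → b≢n∸a (≡.trans (≡.sym (ℕ.m+n∸m≡n a b)) (≡.cong (ℕ._∸ a) e)))

  δ-+ˡ-> : ∀ a b n → n < a → δ (a ℕ.+ b) n ≈ 0#
  δ-+ˡ-> a b n n<a = δ-≢ (λ e → ℕ.<-irrefl ≡.refl (ℕ.<-≤-trans n<a (≡.subst (a ≤_) e (ℕ.m≤m+n a b))))

  δ-*-natR : ∀ m k x → δ m k * (↑ k * x) ≈ δ m k * (↑ m * x)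
  δ-*-natR m k x with m ℕ.≟ k
  ... | yes ≡.refl = refl
  ... | no _       = trans (zeroˡ _) (sym (zeroˡ _))

  Σ-δ : ∀ N m (f : ℕ → Carrier) → m < N → Σ N (λ k → δ k m * f k) ≈ f m
  Σ-δ N m f m<N = trans
    (Σ-single N m m<N (λ i _ i≢m → trans (*-congʳ (δ-≢ i≢m)) (zeroˡ _)))
    (trans (*-congʳ (δ-refl m)) (*-identityˡ _))

  Σ-δ-≥ : ∀ N m (f : ℕ → Carrier) → N ≤ m → Σ N (λ k → δ k m * f k) ≈ 0#
  Σ-δ-≥ N m f N≤m = Σ-≈0 N (λ i i<N →
    trans (*-congʳ (δ-≢ (λ i≡m → ℕ.<-irrefl i≡m (ℕ.<-≤-trans i<N N≤m)))) (zeroˡ _))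

  -- A term δ m n * Z with m ≥ N > n vanishes, so the range of the δ-sum is irrelevant.
  Σ-δ-collapse : ∀ N m n (k : ℕ → ℕ) Z → n < N → m ≤ k m →
                 Σ N (λ i → δ i m * (δ (k i) n * Z)) ≈ δ (k m) n * Z
  Σ-δ-collapse N m n k Z n<N m≤km with m ℕ.<? N
  ... | yes m<N = Σ-δ N m (λ i → δ (k i) n * Z) m<N
  ... | no m≮N  = trans (Σ-δ-≥ N m _ (ℕ.≮⇒≥ m≮N)) (sym (trans (*-congʳ (δ-≢ km≢n)) (zeroˡ _)))
    where
    km≢n : k m ≢ n
    km≢n e = ℕ.<-irrefl ≡.refl (ℕ.<-≤-trans n<N (ℕ.≤-trans (ℕ.≮⇒≥ m≮N) (≡.subst (m ≤_) e m≤km)))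

  infix 4 _≋_
  _≋_ : Series → Series → Set ℓ
  f ≋ g = ∀ n → f n ≈ g n

  ⊗-as-Σδ : ∀ N M n f g → n < N → n < M →
            (f ⊗ g) n ≈ Σ N (λ a → Σ M (λ b → δ (a ℕ.+ b) n * (f a * g b)))
  ⊗-as-Σδ N M n f g n<N n<M = sym (begin
    Σ N (λ a → Σ M (λ b → δ (a ℕ.+ b) n * (f a * g b)))
      ≈⟨ Σ-extend (suc n) N n<N (λ a n<a _ → Σ-≈0 M (λ b _ → trans (*-congʳ (δ-+ˡ-> a b n n<a)) (zeroˡ _))) ⟩
    Σ (suc n) (λ a → Σ M (λ b → δ (a ℕ.+ b) n * (f a * g b)))
      ≈⟨ Σ-cong-< (suc n) (λ a a<1+n → inner a (ℕ.≤-pred a<1+n)) ⟩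
    (f ⊗ g) n ∎)
    where
    inner : ∀ a → a ≤ n → Σ M (λ b → δ (a ℕ.+ b) n * (f a * g b)) ≈ f a * g (n ℕ.∸ a)
    inner a a≤n = trans (Σ-cong M (λ b → *-congʳ (δ-+ˡ a b n a≤n)))
                        (Σ-δ M (n ℕ.∸ a) (λ b → f a * g b) (ℕ.≤-<-trans (ℕ.m∸n≤m n a) n<M))

  ⊗-cong : ∀ {f f′ g g′} → f ≋ f′ → g ≋ g′ → f ⊗ g ≋ f′ ⊗ g′
  ⊗-cong f≋f′ g≋g′ n = Σ-cong (suc n) (λ i → *-cong (f≋f′ i) (g≋g′ (n ℕ.∸ i)))

  ⊗-congˡ : ∀ f {g g′} → g ≋ g′ → f ⊗ g ≋ f ⊗ g′
  ⊗-congˡ f {g} {g′} = ⊗-cong {f} {f} {g} {g′} (λ _ → refl)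

  ⊗-congʳ : ∀ {f f′} g → f ≋ f′ → f ⊗ g ≋ f′ ⊗ g
  ⊗-congʳ {f} {f′} g f≋f′ = ⊗-cong {f} {f′} {g} {g} f≋f′ (λ _ → refl)

  ⊗-comm : ∀ f g → f ⊗ g ≋ g ⊗ f
  ⊗-comm f g n = begin
    (f ⊗ g) n                                              ≈⟨ ⊗-as-Σδ N N n f g ℕ.≤-refl ℕ.≤-refl ⟩
    Σ N (λ a → Σ N (λ b → δ (a ℕ.+ b) n * (f a * g b)))     ≈⟨ Σ-comm N N _ ⟩
    Σ N (λ b → Σ N (λ a → δ (a ℕ.+ b) n * (f a * g b)))
      ≈⟨ Σ-cong N (λ b → Σ-cong N (λ a → *-cong (δ-cong (ℕ.+-comm a b) ≡.refl) (*-comm _ _))) ⟩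
    Σ N (λ b → Σ N (λ a → δ (b ℕ.+ a) n * (g b * f a)))     ≈⟨ ⊗-as-Σδ N N n g f ℕ.≤-refl ℕ.≤-refl ⟨
    (g ⊗ f) n                                              ∎
    where
      N : ℕ
      N = suc n

  private
    Σ²-*ˡ : ∀ N M x (f : ℕ → ℕ → Carrier) →
            x * Σ N (λ a → Σ M (λ b → f a b)) ≈ Σ N (λ a → Σ M (λ b → x * f a b))
    Σ²-*ˡ N M x f = trans (*-distribˡ-Σ N x _) (Σ-cong N (λ a → *-distribˡ-Σ M x _))

    Σ²-*ʳ : ∀ N M x (f : ℕ → ℕ → Carrier) →
            Σ N (λ a → Σ M (λ b → f a b)) * x ≈ Σ N (λ a → Σ M (λ b → f a b * x))
    Σ²-*ʳ N M x f = trans (*-distribʳ-Σ N x _) (Σ-cong N (λ a → *-distribʳ-Σ M x _))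

    Σ³-rotate : ∀ N (f : ℕ → ℕ → ℕ → ℕ → Carrier) →
      Σ N (λ i → Σ N (λ c → Σ N (λ a → Σ N (λ b → f i c a b)))) ≈
      Σ N (λ a → Σ N (λ b → Σ N (λ c → Σ N (λ i → f i c a b))))
    Σ³-rotate N f =
      trans (Σ-comm N N _)
      (trans (Σ-cong N (λ c → trans (Σ-comm N N _) (Σ-cong N (λ a → Σ-comm N N _))))
      (trans (Σ-comm N N _) (Σ-cong N (λ a → Σ-comm N N _))))

  Σδ³ : Series → Series → Series → ℕ → Carrier
  Σδ³ f g h n = Σ N (λ a → Σ N (λ b → Σ N (λ c → δ ((a ℕ.+ b) ℕ.+ c) n * ((f a * g b) * h c))))
    where
      N : ℕ
      N = suc n

  ⊗-assocˡ : ∀ f g h → (f ⊗ g) ⊗ h ≋ Σδ³ f g h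
  ⊗-assocˡ f g h n = begin
    ((f ⊗ g) ⊗ h) n
      ≈⟨ ⊗-as-Σδ N N n (f ⊗ g) h n<N n<N ⟩
    Σ N (λ i → Σ N (λ c → δ (i ℕ.+ c) n * ((f ⊗ g) i * h c)))
      ≈⟨ Σ-cong-< N (λ i i<N → Σ-cong N (λ c → *-congˡ (*-congʳ (⊗-as-Σδ N N i f g i<N i<N)))) ⟩
    Σ N (λ i → Σ N (λ c → δ (i ℕ.+ c) n * (Σ N (λ a → Σ N (λ b → δ (a ℕ.+ b) i * (f a * g b))) * h c)))
      ≈⟨ Σ-cong N (λ i → Σ-cong N (λ c → trans (*-congˡ (Σ²-*ʳ N N (h c) _)) (Σ²-*ˡ N N _ _))) ⟩
    Σ N (λ i → Σ N (λ c → Σ N (λ a → Σ N (λ b → δ (i ℕ.+ c) n * ((δ (a ℕ.+ b) i * (f a * g b)) * h c)))))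
      ≈⟨ Σ-cong N (λ i → Σ-cong N (λ c → Σ-cong N (λ a → Σ-cong N (λ b →
           trans (solve 4 (λ d e x y → d :* ((e :* x) :* y) := e :* (d :* (x :* y))) refl _ _ _ _)
                 (*-congʳ (δ-sym (a ℕ.+ b) i)))))) ⟩
    Σ N (λ i → Σ N (λ c → Σ N (λ a → Σ N (λ b → δ i (a ℕ.+ b) * (δ (i ℕ.+ c) n * ((f a * g b) * h c))))))
      ≈⟨ Σ³-rotate N _ ⟩
    Σ N (λ a → Σ N (λ b → Σ N (λ c → Σ N (λ i → δ i (a ℕ.+ b) * (δ (i ℕ.+ c) n * ((f a * g b) * h c))))))
      ≈⟨ Σ-cong N (λ a → Σ-cong N (λ b → Σ-cong N (λ c →
           Σ-δ-collapse N (a ℕ.+ b) n (ℕ._+ c) _ n<N (ℕ.m≤m+n _ c)))) ⟩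
    Σδ³ f g h n ∎
    where
    N : ℕ
    N = suc n
    n<N : n < N
    n<N = ℕ.≤-refl

  ⊗-assocʳ : ∀ f g h → f ⊗ (g ⊗ h) ≋ Σδ³ f g h
  ⊗-assocʳ f g h n = begin
    (f ⊗ (g ⊗ h)) n
      ≈⟨ ⊗-as-Σδ N N n f (g ⊗ h) n<N n<N ⟩
    Σ N (λ a → Σ N (λ j → δ (a ℕ.+ j) n * (f a * (g ⊗ h) j)))
      ≈⟨ Σ-cong N (λ a → Σ-cong-< N (λ j j<N → *-congˡ (*-congˡ (⊗-as-Σδ N N j g h j<N j<N)))) ⟩
    Σ N (λ a → Σ N (λ j → δ (a ℕ.+ j) n * (f a * Σ N (λ b → Σ N (λ c → δ (b ℕ.+ c) j * (g b * h c))))))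
      ≈⟨ Σ-cong N (λ a → Σ-cong N (λ j → trans (*-congˡ (Σ²-*ˡ N N (f a) _)) (Σ²-*ˡ N N _ _))) ⟩
    Σ N (λ a → Σ N (λ j → Σ N (λ b → Σ N (λ c → δ (a ℕ.+ j) n * (f a * (δ (b ℕ.+ c) j * (g b * h c)))))))
      ≈⟨ Σ-cong N (λ a → Σ-cong N (λ j → Σ-cong N (λ b → Σ-cong N (λ c →
           trans (solve 5 (λ d e x y z → d :* (x :* (e :* (y :* z))) := e :* (d :* ((x :* y) :* z))) refl _ _ _ _ _)
                 (*-congʳ (δ-sym (b ℕ.+ c) j)))))) ⟩
    Σ N (λ a → Σ N (λ j → Σ N (λ b → Σ N (λ c → δ j (b ℕ.+ c) * (δ (a ℕ.+ j) n * ((f a * g b) * h c))))))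
      ≈⟨ Σ-cong N (λ a → trans (Σ-comm N N _) (Σ-cong N (λ b → Σ-comm N N _))) ⟩
    Σ N (λ a → Σ N (λ b → Σ N (λ c → Σ N (λ j → δ j (b ℕ.+ c) * (δ (a ℕ.+ j) n * ((f a * g b) * h c))))))
      ≈⟨ Σ-cong N (λ a → Σ-cong N (λ b → Σ-cong N (λ c →
           trans (Σ-δ-collapse N (b ℕ.+ c) n (a ℕ.+_) _ n<N (ℕ.m≤n+m _ a))
                 (*-congʳ (δ-cong (≡.sym (ℕ.+-assoc a b c)) ≡.refl))))) ⟩
    Σδ³ f g h n ∎
    where
    N : ℕ
    N = suc n
    n<N : n < N
    n<N = ℕ.≤-refl

  ⊗-assoc : ∀ f g h → (f ⊗ g) ⊗ h ≋ f ⊗ (g ⊗ h)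
  ⊗-assoc f g h n = trans (⊗-assocˡ f g h n) (sym (⊗-assocʳ f g h n))

  oneS-⊗ : ∀ f → oneS ⊗ f ≋ f
  oneS-⊗ f n = begin
    (oneS ⊗ f) n                                            ≈⟨ Σ-head n _ ⟩
    1# * f (n ℕ.∸ 0) + Σ n (λ i → 0# * f (n ℕ.∸ suc i))     ≈⟨ +-cong (*-identityˡ _) (Σ-≈0 n (λ i _ → zeroˡ _)) ⟩
    f n + 0#                                                ≈⟨ +-identityʳ _ ⟩
    f n                                                     ∎

  ⊙-⊗ : ∀ a f g → (a ⊙ f) ⊗ g ≋ a ⊙ (f ⊗ g)
  ⊙-⊗ a f g n = trans (Σ-cong (suc n) (λ i → *-assoc _ _ _)) (sym (*-distribˡ-Σ (suc n) a _))

  ⊕-⊗ : ∀ f g h → (f ⊕ g) ⊗ h ≋ (f ⊗ h) ⊕ (g ⊗ h)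
  ⊕-⊗ f g h n = trans (Σ-cong (suc n) (λ i → distribʳ _ _ _)) (Σ-distrib-+ (suc n) _ _)

  powS-cong : ∀ {f g} → f ≋ g → ∀ k → powS f k ≋ powS g k
  powS-cong f≋g zero    n = refl
  powS-cong f≋g (suc k)   = ⊗-cong (powS-cong f≋g k) f≋g

  powS-+ : ∀ u a b → powS u (a ℕ.+ b) ≋ powS u a ⊗ powS u b
  powS-+ u zero    b n = sym (oneS-⊗ (powS u b) n)
  powS-+ u (suc a) b n = begin
    (powS u (a ℕ.+ b) ⊗ u) n          ≈⟨ ⊗-congʳ u (powS-+ u a b) n ⟩
    ((powS u a ⊗ powS u b) ⊗ u) n     ≈⟨ ⊗-assoc (powS u a) (powS u b) u n ⟩
    (powS u a ⊗ (powS u b ⊗ u)) n     ≈⟨ ⊗-congˡ (powS u a) (⊗-comm (powS u b) u) n ⟩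
    (powS u a ⊗ (u ⊗ powS u b)) n     ≈⟨ ⊗-assoc (powS u a) u (powS u b) n ⟨
    ((powS u a ⊗ u) ⊗ powS u b) n     ∎

  powS-vanishes-below : ∀ u → u 0 ≈ 0# → ∀ k n → n < k → powS u k n ≈ 0#
  powS-vanishes-below u u0≈0 (suc k) n n<1+k = Σ-≈0 (suc n) term
    where
    term : ∀ i → i < suc n → powS u k i * u (n ℕ.∸ i) ≈ 0#
    term i i<1+n with i ℕ.<? k
    ... | yes i<k = trans (*-congʳ (powS-vanishes-below u u0≈0 k i i<k)) (zeroˡ _)
    ... | no i≮k  = trans (*-congˡ (trans (reflexive (≡.cong u (ℕ.m≤n⇒m∸n≡0 n≤i))) u0≈0)) (zeroʳ _)
      where
      n≤i : n ≤ i
      n≤i = ℕ.≤-trans (ℕ.≤-pred n<1+k) (ℕ.≮⇒≥ i≮k)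

  tS : Series
  tS zero          = 0#
  tS (suc zero)    = 1#
  tS (suc (suc n)) = 0#

  tS-⊗-zero : ∀ f → (tS ⊗ f) 0 ≈ 0#
  tS-⊗-zero f = trans (+-identityˡ _) (zeroˡ _)

  tS-⊗-suc : ∀ f n → (tS ⊗ f) (suc n) ≈ f n
  tS-⊗-suc f n = trans (Σ-single (suc (suc n)) 1 (s≤s (s≤s z≤n)) off-1) (*-identityˡ _)
    where
    off-1 : ∀ i → i < suc (suc n) → i ≢ 1 → tS i * f (suc n ℕ.∸ i) ≈ 0#
    off-1 zero          _ _   = zeroˡ _
    off-1 (suc zero)    _ i≢1 = ⊥-elim (i≢1 ≡.refl)
    off-1 (suc (suc i)) _ _   = zeroˡ _

  powS-tS : ∀ l j → powS tS l j ≈ δ l j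
  powS-tS zero    zero    = sym (δ-refl 0)
  powS-tS zero    (suc j) = sym (δ-≢ {0} {suc j} (λ ()))
  powS-tS (suc l) zero    = trans (⊗-comm (powS tS l) tS 0) (trans (tS-⊗-zero (powS tS l)) (sym (δ-≢ {suc l} {0} (λ ()))))
  powS-tS (suc l) (suc j) = begin
    (powS tS l ⊗ tS) (suc j)   ≈⟨ ⊗-comm (powS tS l) tS (suc j) ⟩
    (tS ⊗ powS tS l) (suc j)   ≈⟨ tS-⊗-suc (powS tS l) j ⟩
    powS tS l j                ≈⟨ powS-tS l j ⟩
    δ l j                      ≈⟨ δ-suc l j ⟨
    δ (suc l) (suc j)          ∎

  affine : Carrier → Series
  affine a = oneS ⊕ (a ⊙ tS)

  affine-⊗-zero : ∀ a f → (affine a ⊗ f) 0 ≈ f 0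
  affine-⊗-zero a f = begin
    (affine a ⊗ f) 0                     ≈⟨ ⊕-⊗ oneS (a ⊙ tS) f 0 ⟩
    (oneS ⊗ f) 0 + ((a ⊙ tS) ⊗ f) 0      ≈⟨ +-cong (oneS-⊗ f 0) (trans (⊙-⊗ a tS f 0) (trans (*-congˡ (tS-⊗-zero f)) (zeroʳ _))) ⟩
    f 0 + 0#                             ≈⟨ +-identityʳ _ ⟩
    f 0                                  ∎

  affine-⊗-suc : ∀ a f n → (affine a ⊗ f) (suc n) ≈ f (suc n) + a * f n
  affine-⊗-suc a f n = begin
    (affine a ⊗ f) (suc n)                          ≈⟨ ⊕-⊗ oneS (a ⊙ tS) f (suc n) ⟩
    (oneS ⊗ f) (suc n) + ((a ⊙ tS) ⊗ f) (suc n)     ≈⟨ +-cong (oneS-⊗ f (suc n)) (trans (⊙-⊗ a tS f (suc n)) (*-congˡ (tS-⊗-suc f n))) ⟩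
    f (suc n) + a * f n                             ∎

  -- Composition

  infixr 9 _∘ₛ_
  _∘ₛ_ : Series → Series → Series
  (g ∘ₛ u) n = Σ (suc n) (λ k → g k * powS u k n)

  ∘ₛ-as-Σ : ∀ u → u 0 ≈ 0# → ∀ g N n → n < N → (g ∘ₛ u) n ≈ Σ N (λ k → g k * powS u k n)
  ∘ₛ-as-Σ u u0≈0 g N n n<N = sym (Σ-extend (suc n) N n<N
    (λ k n<k _ → trans (*-congˡ (powS-vanishes-below u u0≈0 k n n<k)) (zeroʳ _)))

  ∘ₛ-congˡ : ∀ {g g′} u → g ≋ g′ → g ∘ₛ u ≋ g′ ∘ₛ u
  ∘ₛ-congˡ u g≋g′ n = Σ-cong (suc n) (λ k → *-congʳ (g≋g′ k))

  ∘ₛ-congʳ : ∀ g {u v} → u ≋ v → g ∘ₛ u ≋ g ∘ₛ v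
  ∘ₛ-congʳ g u≋v n = Σ-cong (suc n) (λ k → *-congˡ (powS-cong u≋v k n))

  ⊕-∘ₛ : ∀ g h u → (g ⊕ h) ∘ₛ u ≋ (g ∘ₛ u) ⊕ (h ∘ₛ u)
  ⊕-∘ₛ g h u n = trans (Σ-cong (suc n) (λ k → distribʳ _ _ _)) (Σ-distrib-+ (suc n) _ _)

  ⊖-∘ₛ : ∀ g h u → (g ⊖ h) ∘ₛ u ≋ (g ∘ₛ u) ⊖ (h ∘ₛ u)
  ⊖-∘ₛ g h u n = begin
    Σ (suc n) (λ k → (g k - h k) * powS u k n)
      ≈⟨ Σ-cong (suc n) (λ k → trans (distribʳ _ _ _) (+-congˡ (sym (-‿distribˡ-* _ _)))) ⟩
    Σ (suc n) (λ k → g k * powS u k n + - (h k * powS u k n))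
      ≈⟨ Σ-distrib-+ (suc n) _ _ ⟩
    (g ∘ₛ u) n + Σ (suc n) (λ k → - (h k * powS u k n))
      ≈⟨ +-congˡ (sym (-‿distrib-Σ (suc n) _)) ⟩
    (g ∘ₛ u) n - (h ∘ₛ u) n ∎

  ⊙-∘ₛ : ∀ a g u → (a ⊙ g) ∘ₛ u ≋ a ⊙ (g ∘ₛ u)
  ⊙-∘ₛ a g u n = trans (Σ-cong (suc n) (λ k → *-assoc _ _ _)) (sym (*-distribˡ-Σ (suc n) a _))

  oneS-∘ₛ : ∀ u → oneS ∘ₛ u ≋ oneS
  oneS-∘ₛ u n = trans (Σ-single (suc n) 0 (s≤s z≤n) off-0) (*-identityˡ _)
    where
    off-0 : ∀ i → i < suc n → i ≢ 0 → oneS i * powS u i n ≈ 0#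
    off-0 zero    _ i≢0 = ⊥-elim (i≢0 ≡.refl)
    off-0 (suc i) _ _   = zeroˡ _

  tS≈δ₁ : ∀ k → tS k ≈ δ k 1
  tS≈δ₁ k = trans (sym (oneS-⊗ tS k)) (trans (powS-tS 1 k) (δ-sym 1 k))

  tS-∘ₛ : ∀ u → u 0 ≈ 0# → tS ∘ₛ u ≋ u
  tS-∘ₛ u u0≈0 n = begin
    (tS ∘ₛ u) n                      ≈⟨ ∘ₛ-as-Σ u u0≈0 tS N n (ℕ.m<n⇒m<1+n ℕ.≤-refl) ⟩
    Σ N (λ k → tS k * powS u k n)    ≈⟨ Σ-cong N (λ k → *-congʳ (tS≈δ₁ k)) ⟩
    Σ N (λ k → δ k 1 * powS u k n)   ≈⟨ Σ-δ N 1 (λ k → powS u k n) (s≤s (s≤s z≤n)) ⟩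
    (oneS ⊗ u) n                     ≈⟨ oneS-⊗ u n ⟩
    u n                              ∎
    where
      N : ℕ
      N = suc (suc n)

  ∘ₛ-tS : ∀ g → g ∘ₛ tS ≋ g
  ∘ₛ-tS g n = begin
    Σ (suc n) (λ k → g k * powS tS k n)   ≈⟨ Σ-cong (suc n) (λ k → trans (*-comm _ _) (*-congʳ (powS-tS k n))) ⟩
    Σ (suc n) (λ k → δ k n * g k)         ≈⟨ Σ-δ (suc n) n g ℕ.≤-refl ⟩
    g n                                   ∎

  affine-∘ₛ : ∀ a u → u 0 ≈ 0# → affine a ∘ₛ u ≋ oneS ⊕ (a ⊙ u)
  affine-∘ₛ a u u0≈0 n = trans (⊕-∘ₛ oneS (a ⊙ tS) u n)
    (+-cong (oneS-∘ₛ u n) (trans (⊙-∘ₛ a tS u n) (*-congˡ (tS-∘ₛ u u0≈0 n))))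

  ⊗-Σ : ∀ N n (f v : Series) (g : ℕ → Carrier) (h : ℕ → Series) →
        (∀ i → i ≤ n → f i ≈ Σ N (λ k → g k * h k i)) → (f ⊗ v) n ≈ Σ N (λ k → g k * (h k ⊗ v) n)
  ⊗-Σ N n f v g h f≈Σ = begin
    Σ (suc n) (λ i → f i * v (n ℕ.∸ i))
      ≈⟨ Σ-cong-< (suc n) (λ i i<1+n → *-congʳ (f≈Σ i (ℕ.≤-pred i<1+n))) ⟩
    Σ (suc n) (λ i → Σ N (λ k → g k * h k i) * v (n ℕ.∸ i))
      ≈⟨ Σ-cong (suc n) (λ i → trans (*-distribʳ-Σ N _ _) (Σ-cong N (λ k → *-assoc _ _ _))) ⟩
    Σ (suc n) (λ i → Σ N (λ k → g k * (h k i * v (n ℕ.∸ i))))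
      ≈⟨ Σ-comm (suc n) N _ ⟩
    Σ N (λ k → Σ (suc n) (λ i → g k * (h k i * v (n ℕ.∸ i))))
      ≈⟨ Σ-cong N (λ k → sym (*-distribˡ-Σ (suc n) _ _)) ⟩
    Σ N (λ k → g k * (h k ⊗ v) n) ∎

  module _ (u : Series) (u0≈0 : u 0 ≈ 0#) where

    private
      Σ²-powS : Series → Series → Series
      Σ²-powS f g n = Σ (suc n) (λ a → Σ (suc n) (λ b → (f a * g b) * powS u (a ℕ.+ b) n))

      Σ-δ-powS : ∀ n m Z → Σ (suc n) (λ k → δ k m * (Z * powS u k n)) ≈ Z * powS u m n
      Σ-δ-powS n m Z with m ℕ.<? suc n
      ... | yes m<1+n = Σ-δ (suc n) m (λ k → Z * powS u k n) m<1+n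
      ... | no m≮1+n  = trans (Σ-δ-≥ (suc n) m _ (ℕ.≮⇒≥ m≮1+n))
        (sym (trans (*-congˡ (powS-vanishes-below u u0≈0 m n (ℕ.≮⇒≥ m≮1+n))) (zeroʳ _)))

      ⊗-∘ₛ-Σ² : ∀ f g → (f ⊗ g) ∘ₛ u ≋ Σ²-powS f g
      ⊗-∘ₛ-Σ² f g n = begin
        Σ N (λ k → (f ⊗ g) k * powS u k n)
          ≈⟨ Σ-cong-< N (λ k k<N → *-congʳ (⊗-as-Σδ N N k f g k<N k<N)) ⟩
        Σ N (λ k → Σ N (λ a → Σ N (λ b → δ (a ℕ.+ b) k * (f a * g b))) * powS u k n)
          ≈⟨ Σ-cong N (λ k → Σ²-*ʳ N N _ _) ⟩
        Σ N (λ k → Σ N (λ a → Σ N (λ b → (δ (a ℕ.+ b) k * (f a * g b)) * powS u k n)))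
          ≈⟨ Σ-cong N (λ k → Σ-cong N (λ a → Σ-cong N (λ b → trans (*-assoc _ _ _) (*-congʳ (δ-sym (a ℕ.+ b) k))))) ⟩
        Σ N (λ k → Σ N (λ a → Σ N (λ b → δ k (a ℕ.+ b) * ((f a * g b) * powS u k n))))
          ≈⟨ trans (Σ-comm N N _) (Σ-cong N (λ a → Σ-comm N N _)) ⟩
        Σ N (λ a → Σ N (λ b → Σ N (λ k → δ k (a ℕ.+ b) * ((f a * g b) * powS u k n))))
          ≈⟨ Σ-cong N (λ a → Σ-cong N (λ b → Σ-δ-powS n (a ℕ.+ b) (f a * g b))) ⟩
        Σ²-powS f g n ∎
        where
          N : ℕ
          N = suc n

      ∘ₛ-⊗-∘ₛ-Σ² : ∀ f g → (f ∘ₛ u) ⊗ (g ∘ₛ u) ≋ Σ²-powS f g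
      ∘ₛ-⊗-∘ₛ-Σ² f g n = begin
        ((f ∘ₛ u) ⊗ (g ∘ₛ u)) n
          ≈⟨ ⊗-Σ N n (f ∘ₛ u) (g ∘ₛ u) f (powS u) (λ i i≤n → ∘ₛ-as-Σ u u0≈0 f N i (s≤s i≤n)) ⟩
        Σ N (λ a → f a * (powS u a ⊗ (g ∘ₛ u)) n)
          ≈⟨ Σ-cong N (λ a → trans (*-congˡ (powS-⊗-∘ₛ a)) (*-distribˡ-Σ N _ _)) ⟩
        Σ N (λ a → Σ N (λ b → f a * (g b * powS u (a ℕ.+ b) n)))
          ≈⟨ Σ-cong N (λ a → Σ-cong N (λ b → sym (*-assoc _ _ _))) ⟩
        Σ²-powS f g n ∎
        where
        N : ℕ
        N = suc n
        powS-⊗-∘ₛ : ∀ a → (powS u a ⊗ (g ∘ₛ u)) n ≈ Σ N (λ b → g b * powS u (a ℕ.+ b) n)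
        powS-⊗-∘ₛ a = begin
          (powS u a ⊗ (g ∘ₛ u)) n
            ≈⟨ ⊗-comm _ _ n ⟩
          ((g ∘ₛ u) ⊗ powS u a) n
            ≈⟨ ⊗-Σ N n (g ∘ₛ u) (powS u a) g (powS u) (λ i i≤n → ∘ₛ-as-Σ u u0≈0 g N i (s≤s i≤n)) ⟩
          Σ N (λ b → g b * (powS u b ⊗ powS u a) n)
            ≈⟨ Σ-cong N (λ b → *-congˡ (trans (sym (powS-+ u b a n)) (reflexive (≡.cong (λ e → powS u e n) (ℕ.+-comm b a))))) ⟩
          Σ N (λ b → g b * powS u (a ℕ.+ b) n) ∎

    ⊗-∘ₛ : ∀ f g → (f ⊗ g) ∘ₛ u ≋ (f ∘ₛ u) ⊗ (g ∘ₛ u)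
    ⊗-∘ₛ f g n = trans (⊗-∘ₛ-Σ² f g n) (sym (∘ₛ-⊗-∘ₛ-Σ² f g n))

    powS-∘ₛ : ∀ g l → powS g l ∘ₛ u ≋ powS (g ∘ₛ u) l
    powS-∘ₛ g zero    = oneS-∘ₛ u
    powS-∘ₛ g (suc l) n = trans (⊗-∘ₛ (powS g l) g n) (⊗-congʳ (g ∘ₛ u) (powS-∘ₛ g l) n)

    ∘ₛ-assoc : ∀ g v → v 0 ≈ 0# → (g ∘ₛ v) ∘ₛ u ≋ g ∘ₛ (v ∘ₛ u)
    ∘ₛ-assoc g v v0≈0 n = begin
      Σ N (λ k → (g ∘ₛ v) k * powS u k n)
        ≈⟨ Σ-cong-< N (λ k k<N → trans (*-congʳ (∘ₛ-as-Σ v v0≈0 g N k k<N)) (*-distribʳ-Σ N _ _)) ⟩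
      Σ N (λ k → Σ N (λ l → (g l * powS v l k) * powS u k n))
        ≈⟨ Σ-comm N N _ ⟩
      Σ N (λ l → Σ N (λ k → (g l * powS v l k) * powS u k n))
        ≈⟨ Σ-cong N (λ l → trans (Σ-cong N (λ k → *-assoc _ _ _)) (sym (*-distribˡ-Σ N _ _))) ⟩
      Σ N (λ l → g l * Σ N (λ k → powS v l k * powS u k n))
        ≈⟨ Σ-cong N (λ l → *-congˡ (sym (∘ₛ-as-Σ u u0≈0 (powS v l) N n ℕ.≤-refl))) ⟩
      Σ N (λ l → g l * (powS v l ∘ₛ u) n)
        ≈⟨ Σ-cong N (λ l → *-congˡ (powS-∘ₛ v l n)) ⟩
      (g ∘ₛ (v ∘ₛ u)) n ∎
      where
        N : ℕ
        N = suc n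

  ∂ : Series → Series
  ∂ f n = ↑ (suc n) * f (suc n)

  ∂-oneS : ∀ n → ∂ oneS n ≈ 0#
  ∂-oneS n = zeroʳ _

  Σδ-natR-⊗ : ∀ n f g →
    Σ (suc (suc n)) (λ a → Σ (suc (suc n)) (λ b → δ (a ℕ.+ b) (suc n) * (↑ a * (f a * g b)))) ≈ (∂ f ⊗ g) n
  Σδ-natR-⊗ n f g = begin
    Σ N (λ a → Σ N (λ b → δ (a ℕ.+ b) (suc n) * (↑ a * (f a * g b))))
      ≈⟨ Σ-head (suc n) _ ⟩
    Σ N (λ b → δ b (suc n) * (0# * (f 0 * g b))) +
    Σ (suc n) (λ a → Σ N (λ b → δ (suc a ℕ.+ b) (suc n) * (↑ (suc a) * (f (suc a) * g b))))
      ≈⟨ +-cong (Σ-≈0 N (λ b _ → trans (*-congˡ (zeroˡ _)) (zeroʳ _)))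
                (Σ-cong (suc n) (λ a → Σ-cong N (λ b →
                   trans (*-congʳ (δ-suc (a ℕ.+ b) n)) (*-congˡ (sym (*-assoc _ _ _)))))) ⟩
    0# + Σ (suc n) (λ a → Σ N (λ b → δ (a ℕ.+ b) n * (∂ f a * g b)))
      ≈⟨ +-identityˡ _ ⟩
    Σ (suc n) (λ a → Σ N (λ b → δ (a ℕ.+ b) n * (∂ f a * g b)))
      ≈⟨ ⊗-as-Σδ (suc n) N n (∂ f) g ℕ.≤-refl (ℕ.m<n⇒m<1+n ℕ.≤-refl) ⟨
    (∂ f ⊗ g) n ∎
    where
      N : ℕ
      N = suc (suc n)

  ∂-⊗ : ∀ f g → ∂ (f ⊗ g) ≋ (∂ f ⊗ g) ⊕ (f ⊗ ∂ g)
  ∂-⊗ f g n = begin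
    ↑ (suc n) * (f ⊗ g) (suc n)
      ≈⟨ *-congˡ (⊗-as-Σδ N N (suc n) f g ℕ.≤-refl ℕ.≤-refl) ⟩
    ↑ (suc n) * Σ N (λ a → Σ N (λ b → δ (a ℕ.+ b) (suc n) * (f a * g b)))
      ≈⟨ Σ²-*ˡ N N _ _ ⟩
    Σ N (λ a → Σ N (λ b → ↑ (suc n) * (δ (a ℕ.+ b) (suc n) * (f a * g b))))
      ≈⟨ Σ-cong N (λ a → Σ-cong N (λ b → split-weight a b)) ⟩
    Σ N (λ a → Σ N (λ b → δ (a ℕ.+ b) (suc n) * (↑ a * (f a * g b)) + δ (b ℕ.+ a) (suc n) * (↑ b * (g b * f a))))
      ≈⟨ trans (Σ-cong N (λ a → Σ-distrib-+ N _ _)) (Σ-distrib-+ N _ _) ⟩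
    Σ N (λ a → Σ N (λ b → δ (a ℕ.+ b) (suc n) * (↑ a * (f a * g b)))) +
    Σ N (λ a → Σ N (λ b → δ (b ℕ.+ a) (suc n) * (↑ b * (g b * f a))))
      ≈⟨ +-cong (Σδ-natR-⊗ n f g) (trans (Σ-comm N N _) (trans (Σδ-natR-⊗ n g f) (⊗-comm (∂ g) f n))) ⟩
    (∂ f ⊗ g) n + (f ⊗ ∂ g) n ∎
    where
    N : ℕ
    N = suc (suc n)
    split-weight : ∀ a b → ↑ (suc n) * (δ (a ℕ.+ b) (suc n) * (f a * g b)) ≈
                           δ (a ℕ.+ b) (suc n) * (↑ a * (f a * g b)) + δ (b ℕ.+ a) (suc n) * (↑ b * (g b * f a))
    split-weight a b = begin
      ↑ (suc n) * (δ (a ℕ.+ b) (suc n) * (f a * g b))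
        ≈⟨ solve 3 (λ x d y → x :* (d :* y) := d :* (x :* y)) refl _ _ _ ⟩
      δ (a ℕ.+ b) (suc n) * (↑ (suc n) * (f a * g b))
        ≈⟨ δ-*-natR (a ℕ.+ b) (suc n) _ ⟩
      δ (a ℕ.+ b) (suc n) * (↑ (a ℕ.+ b) * (f a * g b))
        ≈⟨ *-congˡ (*-congʳ (natR-+ a b)) ⟩
      δ (a ℕ.+ b) (suc n) * ((↑ a + ↑ b) * (f a * g b))
        ≈⟨ solve 5 (λ d x y p q → d :* ((x :+ y) :* (p :* q)) := d :* (x :* (p :* q)) :+ d :* (y :* (q :* p))) refl _ _ _ _ _ ⟩
      δ (a ℕ.+ b) (suc n) * (↑ a * (f a * g b)) + δ (a ℕ.+ b) (suc n) * (↑ b * (g b * f a))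
        ≈⟨ +-congˡ (*-congʳ (δ-cong (ℕ.+-comm a b) ≡.refl)) ⟩
      δ (a ℕ.+ b) (suc n) * (↑ a * (f a * g b)) + δ (b ℕ.+ a) (suc n) * (↑ b * (g b * f a)) ∎

  ∂-powS : ∀ u k → ∂ (powS u (suc k)) ≋ ↑ (suc k) ⊙ (powS u k ⊗ ∂ u)
  ∂-powS u zero n = begin
    ∂ (oneS ⊗ u) n                         ≈⟨ ∂-⊗ oneS u n ⟩
    (∂ oneS ⊗ u) n + (oneS ⊗ ∂ u) n        ≈⟨ +-congʳ (Σ-≈0 (suc n) (λ i _ → trans (*-congʳ (∂-oneS i)) (zeroˡ _))) ⟩
    0# + (oneS ⊗ ∂ u) n                    ≈⟨ +-identityˡ _ ⟩
    (oneS ⊗ ∂ u) n                         ≈⟨ trans (*-congʳ (+-identityʳ _)) (*-identityˡ _) ⟨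
    ↑ 1 * (oneS ⊗ ∂ u) n                   ∎
  ∂-powS u (suc k) n = begin
    ∂ (uᵏ⁺¹ ⊗ u) n
      ≈⟨ ∂-⊗ uᵏ⁺¹ u n ⟩
    (∂ uᵏ⁺¹ ⊗ u) n + (uᵏ⁺¹ ⊗ ∂ u) n
      ≈⟨ +-congʳ (⊗-congʳ u (∂-powS u k) n) ⟩
    ((↑ (suc k) ⊙ (powS u k ⊗ ∂ u)) ⊗ u) n + (uᵏ⁺¹ ⊗ ∂ u) n
      ≈⟨ +-congʳ (⊙-⊗ (↑ (suc k)) (powS u k ⊗ ∂ u) u n) ⟩
    ↑ (suc k) * ((powS u k ⊗ ∂ u) ⊗ u) n + (uᵏ⁺¹ ⊗ ∂ u) n
      ≈⟨ +-congʳ (*-congˡ (trans (⊗-assoc (powS u k) (∂ u) u n)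
           (trans (⊗-congˡ (powS u k) (⊗-comm (∂ u) u) n) (sym (⊗-assoc (powS u k) u (∂ u) n))))) ⟩
    ↑ (suc k) * (uᵏ⁺¹ ⊗ ∂ u) n + (uᵏ⁺¹ ⊗ ∂ u) n
      ≈⟨ trans (+-comm _ _) (sym (trans (distribʳ _ _ _) (+-congʳ (*-identityˡ _)))) ⟩
    ↑ (suc (suc k)) * (uᵏ⁺¹ ⊗ ∂ u) n ∎
    where
      uᵏ⁺¹ : Series
      uᵏ⁺¹ = powS u (suc k)

  ∂-∘ₛ : ∀ u → u 0 ≈ 0# → ∀ g → ∂ (g ∘ₛ u) ≋ (∂ g ∘ₛ u) ⊗ ∂ u
  ∂-∘ₛ u u0≈0 g n = begin
    ↑ (suc n) * Σ N (λ k → g k * powS u k (suc n))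
      ≈⟨ *-distribˡ-Σ N _ _ ⟩
    Σ N (λ k → ↑ (suc n) * (g k * powS u k (suc n)))
      ≈⟨ Σ-cong N (λ k → solve 3 (λ x y z → x :* (y :* z) := y :* (x :* z)) refl _ _ _) ⟩
    Σ N (λ k → g k * ∂ (powS u k) n)
      ≈⟨ Σ-head (suc n) _ ⟩
    g 0 * ∂ oneS n + Σ (suc n) (λ k → g (suc k) * ∂ (powS u (suc k)) n)
      ≈⟨ +-cong (trans (*-congˡ (∂-oneS n)) (zeroʳ _)) (Σ-cong (suc n) (λ k → *-congˡ (∂-powS u k n))) ⟩
    0# + Σ (suc n) (λ k → g (suc k) * (↑ (suc k) * (powS u k ⊗ ∂ u) n))
      ≈⟨ +-identityˡ _ ⟩
    Σ (suc n) (λ k → g (suc k) * (↑ (suc k) * (powS u k ⊗ ∂ u) n))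
      ≈⟨ Σ-cong (suc n) (λ k → solve 3 (λ x y z → x :* (y :* z) := (y :* x) :* z) refl _ _ _) ⟩
    Σ (suc n) (λ k → ∂ g k * (powS u k ⊗ ∂ u) n)
      ≈⟨ ⊗-Σ (suc n) n (∂ g ∘ₛ u) (∂ u) (∂ g) (powS u) (λ i i≤n → ∘ₛ-as-Σ u u0≈0 (∂ g) (suc n) i (s≤s i≤n)) ⟨
    ((∂ g ∘ₛ u) ⊗ ∂ u) n ∎
    where
      N : ℕ
      N = suc (suc n)

  -- The differential equation (1 + t) Q' = Q

  natR-suc-*-invSuc : ∀ n → ↑ (suc n) * invSuc n ≈ 1#
  natR-suc-*-invSuc n = inv-inv (↑ (suc n)) (char0 n)

  natR-suc-*-invFact-suc : ∀ n → ↑ (suc n) * invFact (suc n) ≈ invFact n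
  natR-suc-*-invFact-suc n = begin
    ↑ (suc n) * (invFact n * invSuc n)  ≈⟨ solve 3 (λ x a y → x :* (a :* y) := a :* (x :* y)) refl _ _ _ ⟩
    invFact n * (↑ (suc n) * invSuc n)  ≈⟨ *-congˡ (natR-suc-*-invSuc n) ⟩
    invFact n * 1#                      ≈⟨ *-identityʳ _ ⟩
    invFact n                           ∎

  fact-*-invFact : ∀ j → fact j * invFact j ≈ 1#
  fact-*-invFact zero    = *-identityˡ _
  fact-*-invFact (suc j) = begin
    (fact j * ↑ (suc j)) * (invFact j * invSuc j)
      ≈⟨ solve 4 (λ a x b y → (a :* x) :* (b :* y) := (a :* b) :* (x :* y)) refl _ _ _ _ ⟩
    (fact j * invFact j) * (↑ (suc j) * invSuc j)  ≈⟨ *-cong (fact-*-invFact j) (natR-suc-*-invSuc j) ⟩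
    1# * 1#                                        ≈⟨ *-identityˡ _ ⟩
    1#                                             ∎

  natR-suc-*-cancel : ∀ k a → ↑ (suc k) * a ≈ 0# → a ≈ 0#
  natR-suc-*-cancel k a ka≈0 = begin
    a                               ≈⟨ *-identityˡ _ ⟨
    1# * a                          ≈⟨ *-congʳ (natR-suc-*-invSuc k) ⟨
    (↑ (suc k) * invSuc k) * a      ≈⟨ solve 3 (λ x y a → (x :* y) :* a := y :* (x :* a)) refl _ _ _ ⟩
    invSuc k * (↑ (suc k) * a)      ≈⟨ *-congˡ ka≈0 ⟩
    invSuc k * 0#                   ≈⟨ zeroʳ _ ⟩
    0#                              ∎

  affine-ode-unique : ∀ Q → affine 1# ⊗ ∂ Q ≋ Q → Q 0 ≈ 1# → Q ≋ affine 1#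
  affine-ode-unique Q ode Q0≈1 = Q≈
    where
    ↑1* : ∀ x → ↑ 1 * x ≈ x
    ↑1* x = trans (*-congʳ (+-identityʳ _)) (*-identityˡ _)

    Q1≈1 : Q 1 ≈ 1#
    Q1≈1 = trans (sym (↑1* (Q 1))) (trans (sym (affine-⊗-zero 1# (∂ Q) )) (trans (ode 0) Q0≈1))

    recurrence : ∀ n → ↑ (suc (suc n)) * Q (suc (suc n)) + ↑ (suc n) * Q (suc n) ≈ Q (suc n)
    recurrence n = trans (+-congˡ (sym (*-identityˡ _))) (trans (sym (affine-⊗-suc 1# (∂ Q) n)) (ode (suc n)))

    x+y≈z⇒y≈z⇒x≈0 : ∀ {x y z} → x + y ≈ z → y ≈ z → x ≈ 0#
    x+y≈z⇒y≈z⇒x≈0 {x} {y} {z} x+y≈z y≈z = begin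
      x            ≈⟨ solve 2 (λ x y → x := (x :+ y) :- y) refl _ _ ⟩
      (x + y) - y  ≈⟨ +-cong x+y≈z (-‿cong y≈z) ⟩
      z - z        ≈⟨ -‿inverseʳ z ⟩
      0#           ∎

    Q2+≈0 : ∀ n → Q (suc (suc n)) ≈ 0#
    Q2+≈0 zero    = natR-suc-*-cancel 1 _ (x+y≈z⇒y≈z⇒x≈0 (recurrence 0) (↑1* (Q 1)))
    Q2+≈0 (suc n) = natR-suc-*-cancel (suc (suc n)) _
      (x+y≈z⇒y≈z⇒x≈0 (recurrence (suc n)) (trans (*-congˡ (Q2+≈0 n)) (trans (zeroʳ _) (sym (Q2+≈0 n)))))

    Q≈ : Q ≋ affine 1#
    Q≈ zero          = trans Q0≈1 (sym (trans (+-congˡ (zeroʳ _)) (+-identityʳ _)))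
    Q≈ (suc zero)    = trans Q1≈1 (sym (trans (+-identityˡ _) (*-identityʳ _)))
    Q≈ (suc (suc n)) = trans (Q2+≈0 n) (sym (trans (+-identityˡ _) (zeroʳ _)))

  -- Degenerate exponential and logarithm

  ∂-eλ : ∀ λ' n → ∂ (eλ λ') n ≈ eλ λ' n * (1# - ↑ n * λ')
  ∂-eλ λ' n = begin
    ↑ (suc n) * ((f n * (1# - ↑ n * λ')) * (invFact n * invSuc n))
      ≈⟨ solve 5 (λ x a b i y → x :* ((a :* b) :* (i :* y)) := ((a :* i) :* b) :* (x :* y)) refl _ _ _ _ _ ⟩
    ((f n * invFact n) * (1# - ↑ n * λ')) * (↑ (suc n) * invSuc n)  ≈⟨ *-congˡ (natR-suc-*-invSuc n) ⟩
    ((f n * invFact n) * (1# - ↑ n * λ')) * 1#                      ≈⟨ *-identityʳ _ ⟩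
    (f n * invFact n) * (1# - ↑ n * λ')                             ∎
    where
      f : ℕ → Carrier
      f = falling λ' 1#

  eλ-ode : ∀ λ' → affine λ' ⊗ ∂ (eλ λ') ≋ eλ λ'
  eλ-ode λ' zero = begin
    (affine λ' ⊗ ∂ e) 0     ≈⟨ affine-⊗-zero λ' (∂ e) ⟩
    ∂ e 0                   ≈⟨ ∂-eλ λ' 0 ⟩
    e 0 * (1# - 0# * λ')    ≈⟨ *-congˡ (trans (+-congˡ (trans (-‿cong (zeroˡ λ')) -0#≈0#)) (+-identityʳ _)) ⟩
    e 0 * 1#                ≈⟨ *-identityʳ _ ⟩
    e 0                     ∎
    where
      e : Series
      e = eλ λ'
  eλ-ode λ' (suc m) = begin
    (affine λ' ⊗ ∂ e) (suc m)
      ≈⟨ affine-⊗-suc λ' (∂ e) m ⟩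
    ∂ e (suc m) + λ' * ∂ e m
      ≈⟨ +-cong (∂-eλ λ' (suc m)) (*-congˡ (trans (∂-eλ λ' m) (*-congʳ (*-congˡ (sym (natR-suc-*-invFact-suc m)))))) ⟩
    ((f m * (1# - ↑ m * λ')) * I) * (1# - ↑ (suc m) * λ') + λ' * ((f m * (↑ (suc m) * I)) * (1# - ↑ m * λ'))
      ≈⟨ solve 6 (λ a b i x l o → ((a :* b) :* i) :* (o :- x :* l) :+ l :* ((a :* (x :* i)) :* b) := ((a :* b) :* i) :* o) refl _ _ _ _ _ _ ⟩
    ((f m * (1# - ↑ m * λ')) * I) * 1#
      ≈⟨ *-identityʳ _ ⟩
    e (suc m) ∎
    where
    e : Series
    e = eλ λ'
    f : ℕ → Carrier
    f = falling λ' 1#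
    I : Carrier
    I = invFact (suc m)

  module _ (λ' : Carrier) (λ≢0 : ¬ (λ' ≈ 0#)) where

    private
      λ⁻¹ : Carrier
      λ⁻¹ = inv λ' λ≢0
      L : Series
      L = logλ λ' λ≢0
      b : Series
      b = onePlusTPow λ'

      λ*λ⁻¹ : λ' * λ⁻¹ ≈ 1#
      λ*λ⁻¹ = inv-inv λ' λ≢0

      x-0≈x : ∀ x → x - 0# ≈ x
      x-0≈x x = trans (+-congˡ -0#≈0#) (+-identityʳ _)

    logλ-zero : L 0 ≈ 0#
    logλ-zero = trans (*-congˡ (trans (+-congʳ (*-identityˡ _)) (-‿inverseʳ _))) (zeroʳ _)

    ∂-logλ : ∀ n → ∂ L n ≈ λ⁻¹ * (b n * (λ' - ↑ n * 1#))
    ∂-logλ n = begin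
      ↑ (suc n) * (λ⁻¹ * ((g n * (λ' - ↑ n * 1#)) * (invFact n * invSuc n) - 0#))
        ≈⟨ *-congˡ (*-congˡ (x-0≈x _)) ⟩
      ↑ (suc n) * (λ⁻¹ * ((g n * (λ' - ↑ n * 1#)) * (invFact n * invSuc n)))
        ≈⟨ solve 6 (λ x j a c i y → x :* (j :* ((a :* c) :* (i :* y))) := (j :* ((a :* i) :* c)) :* (x :* y)) refl _ _ _ _ _ _ ⟩
      (λ⁻¹ * (b n * (λ' - ↑ n * 1#))) * (↑ (suc n) * invSuc n)  ≈⟨ *-congˡ (natR-suc-*-invSuc n) ⟩
      (λ⁻¹ * (b n * (λ' - ↑ n * 1#))) * 1#                      ≈⟨ *-identityʳ _ ⟩
      λ⁻¹ * (b n * (λ' - ↑ n * 1#))                             ∎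
      where
        g : ℕ → Carrier
        g = falling 1# λ'

    affine-∘ₛ-logλ : affine λ' ∘ₛ L ≋ onePlusTPow λ'
    affine-∘ₛ-logλ n = begin
      (affine λ' ∘ₛ L) n                        ≈⟨ affine-∘ₛ λ' L logλ-zero n ⟩
      oneS n + λ' * (λ⁻¹ * (b n - oneS n))
        ≈⟨ solve 4 (λ o l j B → o :+ l :* (j :* (B :- o)) := o :+ (l :* j) :* (B :- o)) refl _ _ _ _ ⟩
      oneS n + (λ' * λ⁻¹) * (b n - oneS n)      ≈⟨ +-congˡ (trans (*-congʳ λ*λ⁻¹) (*-identityˡ _)) ⟩
      oneS n + (b n - oneS n)                   ≈⟨ solve 2 (λ o B → o :+ (B :- o) := B) refl _ _ ⟩
      b n                                       ∎

    -- (1 + t) log_λ'(1 + t) = (1 + t)^λ = 1 + λ log_λ(1 + t)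
    logλ-ode : affine 1# ⊗ ∂ L ≋ affine λ' ∘ₛ L
    logλ-ode zero = begin
      (affine 1# ⊗ ∂ L) 0                 ≈⟨ affine-⊗-zero 1# (∂ L) ⟩
      ∂ L 0                               ≈⟨ ∂-logλ 0 ⟩
      λ⁻¹ * (b 0 * (λ' - 0# * 1#))        ≈⟨ *-congˡ (*-congˡ (trans (+-congˡ (-‿cong (zeroˡ 1#))) (x-0≈x λ'))) ⟩
      λ⁻¹ * (b 0 * λ')                    ≈⟨ solve 3 (λ j B l → j :* (B :* l) := (l :* j) :* B) refl _ _ _ ⟩
      (λ' * λ⁻¹) * b 0                    ≈⟨ trans (*-congʳ λ*λ⁻¹) (*-identityˡ _) ⟩
      b 0                                 ≈⟨ affine-∘ₛ-logλ 0 ⟨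
      (affine λ' ∘ₛ L) 0                  ∎
    logλ-ode (suc m) = begin
      (affine 1# ⊗ ∂ L) (suc m)
        ≈⟨ affine-⊗-suc 1# (∂ L) m ⟩
      ∂ L (suc m) + 1# * ∂ L m
        ≈⟨ +-cong (∂-logλ (suc m)) (*-congˡ (trans (∂-logλ m) (*-congˡ (*-congʳ (*-congˡ (sym (natR-suc-*-invFact-suc m))))))) ⟩
      λ⁻¹ * (((g m * κ) * I) * (λ' - ↑ (suc m) * 1#)) + 1# * (λ⁻¹ * ((g m * (↑ (suc m) * I)) * κ))
        ≈⟨ solve 7 (λ j a c i x l o → j :* (((a :* c) :* i) :* (l :- x :* o)) :+ o :* (j :* ((a :* (x :* i)) :* c)) := (l :* j) :* ((a :* c) :* i)) refl _ _ _ _ _ _ _ ⟩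
      (λ' * λ⁻¹) * ((g m * κ) * I)
        ≈⟨ trans (*-congʳ λ*λ⁻¹) (*-identityˡ _) ⟩
      b (suc m)
        ≈⟨ affine-∘ₛ-logλ (suc m) ⟨
      (affine λ' ∘ₛ L) (suc m) ∎
      where
      g : ℕ → Carrier
      g = falling 1# λ'
      I : Carrier
      I = invFact (suc m)
      κ : Carrier
      κ = λ' - ↑ m * 1#

    eλ∘logλ-ode : affine 1# ⊗ ∂ (eλ λ' ∘ₛ L) ≋ eλ λ' ∘ₛ L
    eλ∘logλ-ode n = begin
      (affine 1# ⊗ ∂ (e ∘ₛ L)) n               ≈⟨ ⊗-congˡ (affine 1#) (∂-∘ₛ L logλ-zero e) n ⟩
      (affine 1# ⊗ ((∂ e ∘ₛ L) ⊗ ∂ L)) n       ≈⟨ ⊗-assoc (affine 1#) (∂ e ∘ₛ L) (∂ L) n ⟨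
      ((affine 1# ⊗ (∂ e ∘ₛ L)) ⊗ ∂ L) n       ≈⟨ ⊗-congʳ (∂ L) (⊗-comm (affine 1#) (∂ e ∘ₛ L)) n ⟩
      (((∂ e ∘ₛ L) ⊗ affine 1#) ⊗ ∂ L) n       ≈⟨ ⊗-assoc (∂ e ∘ₛ L) (affine 1#) (∂ L) n ⟩
      ((∂ e ∘ₛ L) ⊗ (affine 1# ⊗ ∂ L)) n       ≈⟨ ⊗-congˡ (∂ e ∘ₛ L) logλ-ode n ⟩
      ((∂ e ∘ₛ L) ⊗ (affine λ' ∘ₛ L)) n        ≈⟨ ⊗-∘ₛ L logλ-zero (∂ e) (affine λ') n ⟨
      ((∂ e ⊗ affine λ') ∘ₛ L) n               ≈⟨ ∘ₛ-congˡ L (λ k → trans (⊗-comm (∂ e) (affine λ') k) (eλ-ode λ' k)) n ⟩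
      (e ∘ₛ L) n                               ∎
      where
        e : Series
        e = eλ λ'

    eλ∘logλ : eλ λ' ∘ₛ L ≋ affine 1#
    eλ∘logλ = affine-ode-unique (eλ λ' ∘ₛ L) eλ∘logλ-ode
      (trans (+-identityˡ _) (trans (*-identityʳ _) (*-identityʳ _)))

    eλ-1∘logλ : (eλ λ' ⊖ oneS) ∘ₛ L ≋ tS
    eλ-1∘logλ n = begin
      ((eλ λ' ⊖ oneS) ∘ₛ L) n             ≈⟨ ⊖-∘ₛ (eλ λ') oneS L n ⟩
      (eλ λ' ∘ₛ L) n - (oneS ∘ₛ L) n      ≈⟨ +-cong (eλ∘logλ n) (-‿cong (oneS-∘ₛ L n)) ⟩
      (oneS n + 1# * tS n) - oneS n       ≈⟨ +-congʳ (+-congˡ (*-identityˡ _)) ⟩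
      (oneS n + tS n) - oneS n            ≈⟨ solve 2 (λ o t → (o :+ t) :- o := t) refl _ _ ⟩
      tS n                                ∎

    S1-upper : ∀ j k → j < k → S1 λ' λ≢0 j k ≈ 0#
    S1-upper j k j<k = trans (*-congˡ (trans (*-congˡ (powS-vanishes-below L logλ-zero k j j<k)) (zeroʳ _))) (zeroʳ _)

    S1-phi-inversion : ∀ x N j → j < N → Σ N (λ k → S1 λ' λ≢0 j k * phi λ' k x) ≈ falling λ' x j
    S1-phi-inversion x N j j<N = begin
      Σ N (λ k → (fact j * (invFact k * powS L k j)) * (fact k * (a ∘ₛ E) k))
        ≈⟨ Σ-cong N (λ k → cancel-factorial k) ⟩
      Σ N (λ k → fact j * ((a ∘ₛ E) k * powS L k j))  ≈⟨ *-distribˡ-Σ N _ _ ⟨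
      fact j * Σ N (λ k → (a ∘ₛ E) k * powS L k j)    ≈⟨ *-congˡ (∘ₛ-as-Σ L logλ-zero (a ∘ₛ E) N j j<N) ⟨
      fact j * ((a ∘ₛ E) ∘ₛ L) j                      ≈⟨ *-congˡ (∘ₛ-assoc L logλ-zero a E E0≈0 j) ⟩
      fact j * (a ∘ₛ (E ∘ₛ L)) j                      ≈⟨ *-congˡ (∘ₛ-congʳ a eλ-1∘logλ j) ⟩
      fact j * (a ∘ₛ tS) j                            ≈⟨ *-congˡ (∘ₛ-tS a j) ⟩
      fact j * (falling λ' x j * invFact j)           ≈⟨ solve 3 (λ f y i → f :* (y :* i) := y :* (f :* i)) refl _ _ _ ⟩
      falling λ' x j * (fact j * invFact j)           ≈⟨ *-congˡ (fact-*-invFact j) ⟩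
      falling λ' x j * 1#                             ≈⟨ *-identityʳ _ ⟩
      falling λ' x j                                  ∎
      where
      a : Series
      a = egf (falling λ' x)
      E : Series
      E = eλ λ' ⊖ oneS
      E0≈0 : E 0 ≈ 0#
      E0≈0 = trans (+-congʳ (*-identityʳ _)) (-‿inverseʳ _)
      cancel-factorial : ∀ k → (fact j * (invFact k * powS L k j)) * (fact k * (a ∘ₛ E) k) ≈
                               fact j * ((a ∘ₛ E) k * powS L k j)
      cancel-factorial k = begin
        (fact j * (invFact k * powS L k j)) * (fact k * (a ∘ₛ E) k)
          ≈⟨ solve 5 (λ f i q g c → (f :* (i :* q)) :* (g :* c) := (f :* (c :* q)) :* (g :* i)) refl _ _ _ _ _ ⟩
        (fact j * ((a ∘ₛ E) k * powS L k j)) * (fact k * invFact k)  ≈⟨ *-congˡ (fact-*-invFact k) ⟩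
        (fact j * ((a ∘ₛ E) k * powS L k j)) * 1#                    ≈⟨ *-identityʳ _ ⟩
        fact j * ((a ∘ₛ E) k * powS L k j)                           ∎

theorem12 : ∀ {c ℓ} (F : Field c ℓ) → let open FieldDefs F in
    (λ' : Carrier) (λ≢0 : ¬ (λ' ≈ 0#)) (m : ℕ) {{_ : NonZero m}} (n : ℕ) (x : Carrier) →
      dowling m λ' n x ≈
        sumFromTo 0 n (λ k →
          sumFromTo k n (λ j → S1 λ' λ≢0 j k * W m λ' n j) * phi λ' k x)
theorem12 F λ' λ≢0 m n x =
  sym (Σ-triangular-swap n (S1 λ' λ≢0) (W m λ' n) (λ k → phi λ' k x) (falling λ' x)
         (S1-upper λ' λ≢0) (λ j j≤n → S1-phi-inversion λ' λ≢0 x (suc n) j (s≤s j≤n)))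
  where
  open FieldDefs F
  open FormalPowerSeries F
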